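{- Let $\mathbb{K}$ be a commutative ring and $\mathcal{A}$ a countable relational structure. If $\mathbb{K}[\mathcal{A}]$ is equivariantly Noetherian and $\mathcal{B}$ is a reduct of $\mathcal{A}$, then $\mathbb{K}[\mathcal{B}]$ is also equivariantly Noetherian.
   Context: A relational structure $\mathcal{A}=(A,r_1,\dots,r_n)$ is a countable set with finitely many relations; a relation is definable in $\mathcal{A}$ if it is a Boolean combination of $r_1,\dots,r_n$ (equality is always assumed definable). A reduct of $\mathcal{A}$ is a structure $\mathcal{B}=(A,r'_1,\dots,r'_m)$ on the same carrier set all of whose relations are definable in $\mathcal{A}$. Embeddings of a structure are maps $A\to A$ preserving and reflecting all its relations. $\mathbb{K}[\mathcal{A}]$ is the polynomial ring over $\mathbb{K}$ with variables the elements of $A$, on which embeddings act by renaming variables. An ideal is equivariant if closed under this action; a basis of an equivariant ideal $\mathcal{I}$ is $\mathcal{B}_0\subseteq\mathcal{I}$ such that every element of $\mathcal{I}$ is $\sum_i h_i\cdot\iota_i(g_i)$ with $g_i\in\mathcal{B}_0$, $h_i$ polynomials and $\iota_i$ embeddings; the ring is equivariantly Noetherian if every equivariant ideal has a finite basis (all notions taken with respect to the embeddings of the structure in question). -}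

module Defs where

open import Level using (Level; _⊔_; suc; 0ℓ)
open import Data.Nat using (ℕ)
open import Data.Fin using (Fin)
open import Data.Product using (Σ; _×_; _,_; ∃)
open import Data.Sum using (_⊎_)
open import Data.Unit using (⊤)
open import Data.List using (List; []; _∷_; map; foldr)
open import Data.List.Relation.Unary.All using (All)
open import Data.List.Membership.Propositional using (_∈_)
open import Function using (_∘_; _↣_)
open import Function.Definitions using (Injective)
open import Relation.Nullary using (¬_)
open import Relation.Binary.PropositionalEquality using (_≡_)
open import Algebra.Bundles using (CommutativeRing)

record Structure (A : Set) : Set₁ where
  field
    n     : ℕ
    arity : Fin n → ℕ
    rel   : (i : Fin n) → (Fin (arity i) → A) → Set

Countable : Set → Set
Countable A = A ↣ ℕ

module _ {A : Set} (S : Structure A) where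
  open Structure S

  data Formula (k : ℕ) : Set where
    atom : (i : Fin n) → (Fin (arity i) → Fin k) → Formula k
    eq   : Fin k → Fin k → Formula k
    tt   : Formula k
    neg  : Formula k → Formula k
    and  : Formula k → Formula k → Formula k
    or   : Formula k → Formula k → Formula k

  ⟦_⟧ : ∀ {k} → Formula k → (Fin k → A) → Set
  ⟦ atom i σ ⟧ t = rel i (t ∘ σ)
  ⟦ eq x y ⟧   t = t x ≡ t y
  ⟦ tt ⟧       t = ⊤
  ⟦ neg φ ⟧    t = ¬ (⟦ φ ⟧ t)
  ⟦ and φ ψ ⟧  t = ⟦ φ ⟧ t × ⟦ ψ ⟧ t
  ⟦ or φ ψ ⟧   t = ⟦ φ ⟧ t ⊎ ⟦ ψ ⟧ t

  -- A k-ary relation is definable in S if it is a Boolean combination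
  -- of the relations of S (and equality).
  Definable : ∀ {k} → ((Fin k → A) → Set) → Set
  Definable {k} r = Σ (Formula k) λ φ →
    ∀ t → (r t → ⟦ φ ⟧ t) × (⟦ φ ⟧ t → r t)

  record Embedding : Set where
    field
      fun       : A → A
      injective : Injective _≡_ _≡_ fun
      preserves : ∀ i (t : Fin (arity i) → A) → rel i t → rel i (fun ∘ t)
      reflects  : ∀ i (t : Fin (arity i) → A) → rel i (fun ∘ t) → rel i t

Reduct : {A : Set} → Structure A → Structure A → Set
Reduct SA SB = ∀ i → Definable SA (Structure.rel SB i)

-- The polynomial ring K[A]: the free commutative K-algebra on the
-- variables A, presented as polynomial expressions modulo the least
-- congruence making it a commutative ring and making constants a
-- ring homomorphism from K (respecting K's equality).

module PolyRing {c ℓ} (K : CommutativeRing c ℓ) (A : Set) where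
  private module K = CommutativeRing K

  infixl 6 _+_
  infixl 7 _*_
  infix 4 _≈_

  data Poly : Set c where
    var : A → Poly
    con : K.Carrier → Poly
    _+_ : Poly → Poly → Poly
    _*_ : Poly → Poly → Poly
    -_  : Poly → Poly

  0P 1P : Poly
  0P = con K.0#
  1P = con K.1#

  data _≈_ : Poly → Poly → Set (c ⊔ ℓ) where
    refl   : ∀ {p} → p ≈ p
    sym    : ∀ {p q} → p ≈ q → q ≈ p
    trans  : ∀ {p q r} → p ≈ q → q ≈ r → p ≈ r
    +-cong : ∀ {p p' q q'} → p ≈ p' → q ≈ q' → p + q ≈ p' + q'
    *-cong : ∀ {p p' q q'} → p ≈ p' → q ≈ q' → p * q ≈ p' * q'
    -‿cong : ∀ {p q} → p ≈ q → - p ≈ - q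
    +-assoc : ∀ p q r → (p + q) + r ≈ p + (q + r)
    +-comm  : ∀ p q → p + q ≈ q + p
    +-idˡ   : ∀ p → 0P + p ≈ p
    -‿invˡ  : ∀ p → (- p) + p ≈ 0P
    *-assoc : ∀ p q r → (p * q) * r ≈ p * (q * r)
    *-comm  : ∀ p q → p * q ≈ q * p
    *-idˡ   : ∀ p → 1P * p ≈ p
    distribˡ : ∀ p q r → p * (q + r) ≈ (p * q) + (p * r)
    con-cong : ∀ {a b} → a K.≈ b → con a ≈ con b
    con-+    : ∀ a b → con (a K.+ b) ≈ con a + con b
    con-*    : ∀ a b → con (a K.* b) ≈ con a * con b
    con-neg  : ∀ a → con (K.- a) ≈ - con a

  rename : (A → A) → Poly → Poly
  rename f (var x)  = var (f x)
  rename f (con a)  = con a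
  rename f (p + q)  = rename f p + rename f q
  rename f (p * q)  = rename f p * rename f q
  rename f (- p)    = - rename f p

  sumP : List Poly → Poly
  sumP = foldr _+_ 0P

  record IsIdeal {ℓI} (I : Poly → Set ℓI) : Set (c ⊔ ℓ ⊔ ℓI) where
    field
      respects : ∀ {p q} → p ≈ q → I p → I q
      zero     : I 0P
      +-closed : ∀ {p q} → I p → I q → I (p + q)
      *-closed : ∀ h {p} → I p → I (h * p)

  module _ (S : Structure A) where

    Equivariant : ∀ {ℓI} → (Poly → Set ℓI) → Set (c ⊔ ℓI)
    Equivariant I = ∀ (ι : Embedding S) {p} → I p → I (rename (Embedding.fun ι) p)

    record Generated (B₀ : List Poly) (p : Poly) : Set (c ⊔ ℓ) where
      field
        terms    : List (Poly × Embedding S × Poly)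
        inBasis  : All (λ { (h , ι , g) → g ∈ B₀ }) terms
        equation : p ≈ sumP (map (λ { (h , ι , g) → h * rename (Embedding.fun ι) g }) terms)

    IsBasis : ∀ {ℓI} → (Poly → Set ℓI) → List Poly → Set (c ⊔ ℓ ⊔ ℓI)
    IsBasis I B₀ = All I B₀ × (∀ {p} → I p → Generated B₀ p)

    EqNoetherian : (ℓI : Level) → Set (c ⊔ ℓ ⊔ Level.suc ℓI)
    EqNoetherian ℓI = ∀ (I : Poly → Set ℓI) → IsIdeal I → Equivariant I →
                      Σ (List Poly) (IsBasis I)

-- Embeddings preserve and reflect every quantifier-free formula, so each
-- embedding of A preserves and reflects the relations of a reduct B, i.e. it
-- is an embedding of B.  Hence an ideal equivariant for B is equivariant for
-- A, a finite basis relative to the embeddings of A exists by hypothesis, and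
-- it is also a basis relative to the larger set of embeddings of B.
module Submission where

open import Defs
open import Level using (Level)
open import Algebra.Bundles using (CommutativeRing)
open import Data.Product using (_×_; _,_; proj₁; proj₂)
open import Data.Sum using (inj₁; inj₂)
open import Data.Fin using (Fin)
open import Data.List using (map)
open import Data.List.Properties using (map-∘; map-cong)
import Data.List.Relation.Unary.All.Properties as All
open import Function using (_∘_)
open import Relation.Binary.PropositionalEquality
  using (_≡_; refl; cong; subst; sym; trans)

module _ {A : Set} {S : Structure A} (ι : Embedding S) where
  open Embedding ι

  ⟦⟧-preserved : ∀ {k} (φ : Formula S k) t → ⟦ S ⟧ φ t → ⟦ S ⟧ φ (fun ∘ t)
  ⟦⟧-reflected : ∀ {k} (φ : Formula S k) t → ⟦ S ⟧ φ (fun ∘ t) → ⟦ S ⟧ φ t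

  ⟦⟧-preserved (atom i σ) t r          = preserves i (t ∘ σ) r
  ⟦⟧-preserved (eq x y)   t x≡y        = cong fun x≡y
  ⟦⟧-preserved tt         t _          = _
  ⟦⟧-preserved (neg φ)    t ¬φ φι      = ¬φ (⟦⟧-reflected φ t φι)
  ⟦⟧-preserved (and φ ψ)  t (φt , ψt)  = ⟦⟧-preserved φ t φt , ⟦⟧-preserved ψ t ψt
  ⟦⟧-preserved (or φ ψ)   t (inj₁ φt)  = inj₁ (⟦⟧-preserved φ t φt)
  ⟦⟧-preserved (or φ ψ)   t (inj₂ ψt)  = inj₂ (⟦⟧-preserved ψ t ψt)

  ⟦⟧-reflected (atom i σ) t r          = reflects i (t ∘ σ) r
  ⟦⟧-reflected (eq x y)   t fx≡fy      = injective fx≡fy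
  ⟦⟧-reflected tt         t _          = _
  ⟦⟧-reflected (neg φ)    t ¬φι φt     = ¬φι (⟦⟧-preserved φ t φt)
  ⟦⟧-reflected (and φ ψ)  t (φt , ψt)  = ⟦⟧-reflected φ t φt , ⟦⟧-reflected ψ t ψt
  ⟦⟧-reflected (or φ ψ)   t (inj₁ φt)  = inj₁ (⟦⟧-reflected φ t φt)
  ⟦⟧-reflected (or φ ψ)   t (inj₂ ψt)  = inj₂ (⟦⟧-reflected ψ t ψt)

  definable-preserved : ∀ {k} {r : (Fin k → A) → Set} → Definable S r →
                        ∀ t → r t → r (fun ∘ t)
  definable-preserved (φ , r⇔φ) t rt =
    proj₂ (r⇔φ (fun ∘ t)) (⟦⟧-preserved φ t (proj₁ (r⇔φ t) rt))

  definable-reflected : ∀ {k} {r : (Fin k → A) → Set} → Definable S r →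
                        ∀ t → r (fun ∘ t) → r t
  definable-reflected (φ , r⇔φ) t rιt =
    proj₂ (r⇔φ t) (⟦⟧-reflected φ t (proj₁ (r⇔φ (fun ∘ t)) rιt))

record EmbeddingsIncluded {A : Set} (SA SB : Structure A) : Set where
  field
    lift     : Embedding SA → Embedding SB
    lift-fun : ∀ ι → Embedding.fun (lift ι) ≡ Embedding.fun ι

reduct⇒embeddingsIncluded : {A : Set} {SA SB : Structure A} →
                            Reduct SA SB → EmbeddingsIncluded SA SB
reduct⇒embeddingsIncluded red = record
  { lift     = λ ι → record
    { fun       = Embedding.fun ι
    ; injective = Embedding.injective ι
    ; preserves = λ i → definable-preserved ι (red i)
    ; reflects  = λ i → definable-reflected ι (red i)
    }
  ; lift-fun = λ _ → refl
  }

module _ {c ℓ} (K : CommutativeRing c ℓ) {A : Set} {SA SB : Structure A}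
         (incl : EmbeddingsIncluded SA SB) where
  open PolyRing K A
    using (Poly; _≈_; _*_; rename; sumP; Equivariant; Generated; IsBasis; EqNoetherian)
  open EmbeddingsIncluded incl

  rename-lift : ∀ ι p → rename (Embedding.fun (lift ι)) p ≡ rename (Embedding.fun ι) p
  rename-lift ι p = cong (λ f → rename f p) (lift-fun ι)

  equivariant-restrict : ∀ {ℓI} {I : Poly → Set ℓI} → Equivariant SB I → Equivariant SA I
  equivariant-restrict {I = I} eqvB ι {p} Ip = subst I (rename-lift ι p) (eqvB (lift ι) Ip)

  generated-lift : ∀ {B₀ p} → Generated SA B₀ p → Generated SB B₀ p
  generated-lift {p = p} gen = record
    { terms    = map liftTerm terms
    ; inBasis  = All.map⁺ inBasis
    ; equation = subst (λ ts → p ≈ sumP ts) (sym summands-lift) equation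
    }
    where
      open Generated gen

      liftTerm : Poly × Embedding SA × Poly → Poly × Embedding SB × Poly
      liftTerm (h , ι , g) = h , lift ι , g

      summand : ∀ (S : Structure A) → Poly × Embedding S × Poly → Poly
      summand S (h , ι , g) = h * rename (Embedding.fun ι) g

      summands-lift : map (summand SB) (map liftTerm terms) ≡ map (summand SA) terms
      summands-lift = trans (sym (map-∘ terms))
        (map-cong (λ { (h , ι , g) → cong (h *_) (rename-lift ι g) }) terms)

  isBasis-lift : ∀ {ℓI} {I : Poly → Set ℓI} {B₀} → IsBasis SA I B₀ → IsBasis SB I B₀
  isBasis-lift (B₀⊆I , generates) = B₀⊆I , generated-lift ∘ generates

  eqNoetherian-lift : ∀ {ℓI} → EqNoetherian SA ℓI → EqNoetherian SB ℓI
  eqNoetherian-lift noetherianA I isIdeal eqvB =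
    let B₀ , basis = noetherianA I isIdeal (equivariant-restrict eqvB)
    in  B₀ , isBasis-lift basis

lemma3p3 : ∀ {c ℓ} (ℓI : Level) (K : CommutativeRing c ℓ) (A : Set) → Countable A →
           (SA SB : Structure A) → Reduct SA SB →
           PolyRing.EqNoetherian K A SA ℓI → PolyRing.EqNoetherian K A SB ℓI
lemma3p3 ℓI K A _ SA SB reduct =
  eqNoetherian-lift K (reduct⇒embeddingsIncluded reduct)
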